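{- Let $a,b,c$ be commuting indeterminates and let $D$ be the derivation of $\mathbb{Q}[a,b,c]$ determined by $D(a)=ab^2$, $D(b)=b^2c$, $D(c)=bc^2$. For $n\ge1$ define integers $p(n,k)$ and $q(n,k)$ by $$x(x+2)(x+4)\cdots(x+2n-2)=\sum_{k=1}^np(n,k)x^k,\qquad (x+1)(x+3)\cdots(x+2n-1)=\sum_{k=0}^nq(n,k)x^k.$$ Then for all $n\ge1$, $$D^n(a)=ab^n\sum_{k=1}^np(n,k)b^kc^{n-k}\quad\text{and}\quad D^n(ab)=ab^{n+1}\sum_{k=0}^nq(n,k)b^kc^{n-k}.$$
   Context: $D$ is the formal derivative of the context-free grammar $\{a\rightarrow ab^2, b\rightarrow b^2c, c\rightarrow bc^2\}$, i.e. a linear map satisfying the Leibniz rule $D(uv)=D(u)v+uD(v)$. -}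

module Defs where

open import Data.Nat as ℕ using (ℕ; zero; suc; _∸_)
open import Data.Integer as ℤ using (ℤ)
open import Data.Rational as ℚ using (ℚ; 0ℚ; 1ℚ)
open import Data.Product using (_×_; _,_)
open import Data.List using (List; []; _∷_; _++_; map; concatMap; foldr; upTo)
open import Data.Bool using (Bool; true; false; _∧_)
open import Relation.Binary.PropositionalEquality using (_≡_)
open import Function using (_∘_)

-- Polynomials in ℚ[a,b,c], represented as finite formal sums of terms
-- q · a^i b^j c^k.  Two representations denote the same polynomial iff
-- all their coefficients agree (see _≈_).

Mon : Set
Mon = ℕ × ℕ × ℕ           -- exponents (i , j , k) of a^i b^j c^k

Term : Set
Term = ℚ × Mon

Poly : Set
Poly = List Term

coeff : Poly → Mon → ℚ
coeff [] _ = 0ℚ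
coeff ((q , i , j , k) ∷ p) (i' , j' , k') with (i ℕ.≡ᵇ i') ∧ (j ℕ.≡ᵇ j') ∧ (k ℕ.≡ᵇ k')
... | true  = q ℚ.+ coeff p (i' , j' , k')
... | false = coeff p (i' , j' , k')

infix 4 _≈_
_≈_ : Poly → Poly → Set
p ≈ q = ∀ m → coeff p m ≡ coeff q m

0P : Poly
0P = []

const : ℚ → Poly
const q = (q , 0 , 0 , 0) ∷ []

varA varB varC : Poly
varA = (1ℚ , 1 , 0 , 0) ∷ []
varB = (1ℚ , 0 , 1 , 0) ∷ []
varC = (1ℚ , 0 , 0 , 1) ∷ []

infixl 6 _+P_
infixl 7 _*P_
infixr 8 _^P_

_+P_ : Poly → Poly → Poly
_+P_ = _++_

mulTerm : Term → Term → Term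
mulTerm (q , i , j , k) (q' , i' , j' , k') = (q ℚ.* q' , i ℕ.+ i' , j ℕ.+ j' , k ℕ.+ k')

_*P_ : Poly → Poly → Poly
p *P q = concatMap (λ t → map (mulTerm t) q) p

scale : ℚ → Poly → Poly
scale q p = const q *P p

_^P_ : Poly → ℕ → Poly
p ^P zero = const 1ℚ
p ^P suc n = p *P (p ^P n)

mon : Mon → Poly
mon m = (1ℚ , m) ∷ []

Da Db Dc : Poly
Da = varA *P varB ^P 2
Db = varB ^P 2 *P varC
Dc = varB *P varC ^P 2

Dmon : ℕ → ℕ → ℕ → Poly
Dmon (suc i) j k = Da *P mon (i , j , k) +P varA *P Dmon i j k
Dmon zero (suc j) k = Db *P mon (0 , j , k) +P varB *P Dmon 0 j k
Dmon zero zero (suc k) = Dc *P mon (0 , 0 , k) +P varC *P Dmon 0 0 k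
Dmon zero zero zero = 0P

D : Poly → Poly
D [] = []
D ((q , i , j , k) ∷ p) = scale q (Dmon i j k) +P D p

D^ : ℕ → Poly → Poly
D^ zero p = p
D^ (suc n) p = D (D^ n p)

-- Univariate integer polynomials as coefficient lists (constant first),
-- used to define p(n,k) and q(n,k).

UPoly : Set
UPoly = List ℤ

-- multiplication by the linear factor (x + c)
mulLin : ℤ → UPoly → UPoly
mulLin c p = zipAdd (map (c ℤ.*_) p) (ℤ.0ℤ ∷ p)
  where
  zipAdd : UPoly → UPoly → UPoly
  zipAdd [] ys = ys
  zipAdd xs [] = xs
  zipAdd (x ∷ xs) (y ∷ ys) = (x ℤ.+ y) ∷ zipAdd xs ys

ucoeff : UPoly → ℕ → ℤ
ucoeff [] _ = ℤ.0ℤ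
ucoeff (x ∷ _) zero = x
ucoeff (_ ∷ xs) (suc k) = ucoeff xs k

prodLin : (ℕ → ℤ) → ℕ → UPoly
prodLin f zero = ℤ.1ℤ ∷ []
prodLin f (suc n) = mulLin (f n) (prodLin f n)

pnk : ℕ → ℕ → ℤ
pnk n k = ucoeff (prodLin (λ i → ℤ.+ (2 ℕ.* i)) n) k

qnk : ℕ → ℕ → ℤ
qnk n k = ucoeff (prodLin (λ i → ℤ.+ (2 ℕ.* i ℕ.+ 1)) n) k

-- finite sums Σ_{k=lo}^{hi} f k  (hi inclusive) in ℚ[a,b,c]
sumFromTo : ℕ → ℕ → (ℕ → Poly) → Poly
sumFromTo lo hi f = foldr (λ k acc → f (lo ℕ.+ k) +P acc) 0P (upTo (suc hi ∸ lo))

intP : ℤ → Poly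
intP z = const (z ℚ./ 1)

module Submission where

-- Write hom u v f = a·b^u·Σ_{k=0}^{v} f(k) b^k c^(v−k).
-- Since D = b²·(a∂/∂a) + bc·(b∂/∂b + c∂/∂c), D sends a b^(u+k) c^(v−k) to
-- a b^(u+k+2) c^(v−k) + (u+v)·a b^(u+k+1) c^(v−k+1); on coefficient sequences
-- D(hom u v f) = hom (u+1) (v+1) ((x+u+v)·f)   (D-hom).
-- Starting from a b^u = hom u 0 1, induction gives
-- D^n(a b^u) = hom (u+n) n (∏_{i<n} (x+u+2i))   (D-power);
-- u = 0 and u = 1 are the two formulas, the term k = 0 of the first vanishing
-- because x divides x(x+2)⋯(x+2n−2).

open import Defs
open import Algebra.Bundles using (CommutativeMonoid)
open import Data.Bool using (Bool; true; false; _∧_; T)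
open import Data.Bool.Properties using (∧-commutativeMonoid; T-∧)
open import Algebra.Properties.CommutativeSemigroup
  (CommutativeMonoid.commutativeSemigroup ∧-commutativeMonoid) using (interchange)
open import Data.Nat as ℕ using (ℕ; zero; suc; _+_; _*_; _∸_; _≤_; _<_; s≤s; _≤ᵇ_; _≡ᵇ_)
import Data.Nat.Properties as ℕP
open import Data.Integer as ℤ using (ℤ)
import Data.Integer.Properties as ℤP
open import Data.Rational as ℚ using (ℚ; 0ℚ; 1ℚ)
import Data.Rational.Properties as ℚP
import Data.Rational.Unnormalised as ℚᵘ
import Data.Rational.Unnormalised.Properties as ℚᵘP
open import Data.Rational.Solver using (module +-*-Solver)
open import Data.Product using (_×_; _,_; proj₁; proj₂)
open import Data.List using ([]; _∷_; _++_; map; foldr; applyUpTo)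
import Data.List.Properties as ListP
open import Function using (_∘_)
open import Function.Bundles using (Equivalence)
open import Relation.Binary.PropositionalEquality
open +-*-Solver using (solve; _:+_; _:*_; _:=_; con)

ι : ℤ → ℚ
ι z = z ℚ./ 1

toℚᵘ-ι : ∀ z → ℚ.toℚᵘ (ι z) ℚᵘ.≃ ℚᵘ.mkℚᵘ z 0
toℚᵘ-ι z = ℚP.toℚᵘ-fromℚᵘ (ℚᵘ.mkℚᵘ z 0)

ι-+ : ∀ a b → ι (a ℤ.+ b) ≡ ι a ℚ.+ ι b
ι-+ a b = ℚP.toℚᵘ-injective (begin
  ℚ.toℚᵘ (ι (a ℤ.+ b))                ≈⟨ toℚᵘ-ι (a ℤ.+ b) ⟩
  ℚᵘ.mkℚᵘ (a ℤ.+ b) 0                 ≈⟨ ℚᵘ.*≡* (cong (ℤ._* ℤ.+ 1) (cong₂ ℤ._+_ (ℤP.*-identityʳ a) (ℤP.*-identityʳ b))) ⟨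
  ℚᵘ.mkℚᵘ a 0 ℚᵘ.+ ℚᵘ.mkℚᵘ b 0        ≈⟨ ℚᵘP.+-cong (toℚᵘ-ι a) (toℚᵘ-ι b) ⟨
  ℚ.toℚᵘ (ι a) ℚᵘ.+ ℚ.toℚᵘ (ι b)      ≈⟨ ℚP.toℚᵘ-homo-+ (ι a) (ι b) ⟨
  ℚ.toℚᵘ (ι a ℚ.+ ι b)                ∎)
  where open ℚᵘP.≃-Reasoning

ι-* : ∀ a b → ι (a ℤ.* b) ≡ ι a ℚ.* ι b
ι-* a b = ℚP.toℚᵘ-injective (begin
  ℚ.toℚᵘ (ι (a ℤ.* b))                ≈⟨ toℚᵘ-ι (a ℤ.* b) ⟩
  ℚᵘ.mkℚᵘ (a ℤ.* b) 0                 ≈⟨ ℚᵘP.*-cong (toℚᵘ-ι a) (toℚᵘ-ι b) ⟨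
  ℚ.toℚᵘ (ι a) ℚᵘ.* ℚ.toℚᵘ (ι b)      ≈⟨ ℚP.toℚᵘ-homo-* (ι a) (ι b) ⟨
  ℚ.toℚᵘ (ι a ℚ.* ι b)                ∎)
  where open ℚᵘP.≃-Reasoning

ν : ℕ → ℚ
ν n = ι (ℤ.+ n)

ν-suc : ∀ n → ν (suc n) ≡ 1ℚ ℚ.+ ν n
ν-suc n = ι-+ (ℤ.+ 1) (ℤ.+ n)

_⊕_ : Mon → Mon → Mon
(i , j , k) ⊕ (i' , j' , k') = (i + i' , j + j' , k + k')

_⊖_ : Mon → Mon → Mon
(i , j , k) ⊖ (i' , j' , k') = (i ∸ i' , j ∸ j' , k ∸ k')

_=ᵇ_ : Mon → Mon → Bool
(i , j , k) =ᵇ (i' , j' , k') = (i ≡ᵇ i') ∧ (j ≡ᵇ j') ∧ (k ≡ᵇ k')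

_∣ᵇ_ : Mon → Mon → Bool
(i , j , k) ∣ᵇ (i' , j' , k') = (i ≤ᵇ i') ∧ (j ≤ᵇ j') ∧ (k ≤ᵇ k')

=ᵇ-sound : ∀ t t' → T (t =ᵇ t') → t ≡ t'
=ᵇ-sound (i , j , k) (i' , j' , k') eq =
  cong₂ _,_ (ℕP.≡ᵇ⇒≡ i i' (proj₁ ij)) (cong₂ _,_ (ℕP.≡ᵇ⇒≡ j j' (proj₁ jk)) (ℕP.≡ᵇ⇒≡ k k' (proj₂ jk)))
  where
  ij : T (i ≡ᵇ i') × T ((j ≡ᵇ j') ∧ (k ≡ᵇ k'))
  ij = Equivalence.to T-∧ eq
  jk : T (j ≡ᵇ j') × T (k ≡ᵇ k')
  jk = Equivalence.to T-∧ (proj₂ ij)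

≡ᵇ-+ : ∀ a b c → (a + b ≡ᵇ c) ≡ (a ≤ᵇ c) ∧ (b ≡ᵇ c ∸ a)
≡ᵇ-+ zero b c = refl
≡ᵇ-+ (suc a) b zero = refl
≡ᵇ-+ (suc zero) b (suc c) = refl
≡ᵇ-+ (suc (suc a)) b (suc c) = ≡ᵇ-+ (suc a) b c

=ᵇ-⊕ : ∀ s t m → (s ⊕ t) =ᵇ m ≡ (s ∣ᵇ m) ∧ (t =ᵇ (m ⊖ s))
=ᵇ-⊕ (i , j , k) (i' , j' , k') (a , b , c)
  rewrite ≡ᵇ-+ i i' a | ≡ᵇ-+ j j' b | ≡ᵇ-+ k k' c =
  trans (cong (((i ≤ᵇ a) ∧ (i' ≡ᵇ a ∸ i)) ∧_) (interchange (j ≤ᵇ b) (j' ≡ᵇ b ∸ j) (k ≤ᵇ c) (k' ≡ᵇ c ∸ k)))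
        (interchange (i ≤ᵇ a) (i' ≡ᵇ a ∸ i) ((j ≤ᵇ b) ∧ (k ≤ᵇ c)) ((j' ≡ᵇ b ∸ j) ∧ (k' ≡ᵇ c ∸ k)))

guard : Bool → ℚ → ℚ
guard true x = x
guard false _ = 0ℚ

guard-∧ : ∀ a b x → guard (a ∧ b) x ≡ guard a (guard b x)
guard-∧ true b x = refl
guard-∧ false b x = refl

guard-0 : ∀ b → guard b 0ℚ ≡ 0ℚ
guard-0 true = refl
guard-0 false = refl

guard-+ : ∀ b x y → guard b (x ℚ.+ y) ≡ guard b x ℚ.+ guard b y
guard-+ true x y = refl
guard-+ false x y = sym (ℚP.+-identityˡ 0ℚ)

guard-* : ∀ b q x → guard b (q ℚ.* x) ≡ q ℚ.* guard b x
guard-* true q x = refl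
guard-* false q x = sym (ℚP.*-zeroʳ q)

δ : Mon → Mon → ℚ
δ t m = guard (t =ᵇ m) 1ℚ

δ-weight : ∀ (w : Mon → ℚ) t t' → w t' ℚ.* δ t t' ≡ w t ℚ.* δ t t'
δ-weight w t t' = at (t =ᵇ t') (λ eq → cong w (sym (=ᵇ-sound t t' eq)))
  where
  at : ∀ b → (T b → w t' ≡ w t) → w t' ℚ.* guard b 1ℚ ≡ w t ℚ.* guard b 1ℚ
  at true eq = cong (ℚ._* 1ℚ) (eq _)
  at false _ = trans (ℚP.*-zeroʳ (w t')) (sym (ℚP.*-zeroʳ (w t)))

coef : Poly → Mon → ℚ
coef [] m = 0ℚ
coef ((q , t) ∷ p) m = q ℚ.* δ t m ℚ.+ coef p m

coeff≡coef : ∀ p m → coeff p m ≡ coef p m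
coeff≡coef [] m = refl
coeff≡coef ((q , i , j , k) ∷ p) (i' , j' , k') with (i ℕ.≡ᵇ i') ∧ (j ℕ.≡ᵇ j') ∧ (k ℕ.≡ᵇ k')
... | true  = cong₂ ℚ._+_ (sym (ℚP.*-identityʳ q)) (coeff≡coef p _)
... | false = trans (coeff≡coef p _) (sym (trans (cong (ℚ._+ coef p _) (ℚP.*-zeroʳ q)) (ℚP.+-identityˡ _)))

≈-fromCoef : ∀ p p' → (∀ m → coef p m ≡ coef p' m) → p ≈ p'
≈-fromCoef p p' eq m = trans (coeff≡coef p m) (trans (eq m) (sym (coeff≡coef p' m)))

coef-++ : ∀ p p' m → coef (p ++ p') m ≡ coef p m ℚ.+ coef p' m
coef-++ [] p' m = sym (ℚP.+-identityˡ _)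
coef-++ ((q , t) ∷ p) p' m =
  trans (cong (q ℚ.* δ t m ℚ.+_) (coef-++ p p' m)) (sym (ℚP.+-assoc (q ℚ.* δ t m) (coef p m) (coef p' m)))

-- If f lists the coefficients of p, then 'raise s f' lists those of x^s·p:
-- the coefficient of m is f (m / s) when s divides m, and 0 otherwise.

raise : Mon → (Mon → ℚ) → Mon → ℚ
raise s f m = guard (s ∣ᵇ m) (f (m ⊖ s))

raise-cong : ∀ s f g → (∀ t → f t ≡ g t) → ∀ m → raise s f m ≡ raise s g m
raise-cong s f g eq m = cong (guard (s ∣ᵇ m)) (eq (m ⊖ s))

raise-lin : ∀ s q f g m → raise s (λ t → q ℚ.* f t ℚ.+ g t) m ≡ q ℚ.* raise s f m ℚ.+ raise s g m
raise-lin s q f g m =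
  trans (guard-+ (s ∣ᵇ m) _ _) (cong (ℚ._+ raise s g m) (guard-* (s ∣ᵇ m) q _))

δ-⊕ : ∀ s t m → δ (s ⊕ t) m ≡ raise s (δ t) m
δ-⊕ s t m = trans (cong (λ b → guard b 1ℚ) (=ᵇ-⊕ s t m)) (guard-∧ (s ∣ᵇ m) (t =ᵇ (m ⊖ s)) 1ℚ)

coef-mulTerm : ∀ r s p m → coef (map (mulTerm (r , s)) p) m ≡ r ℚ.* raise s (coef p) m
coef-mulTerm r s [] m = sym (trans (cong (r ℚ.*_) (guard-0 (s ∣ᵇ m))) (ℚP.*-zeroʳ r))
coef-mulTerm r s@(i , j , k) ((q , t@(i' , j' , k')) ∷ p) m = begin
  (r ℚ.* q) ℚ.* δ (s ⊕ t) m ℚ.+ coef (map (mulTerm (r , s)) p) m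
    ≡⟨ cong₂ (λ x y → (r ℚ.* q) ℚ.* x ℚ.+ y) (δ-⊕ s t m) (coef-mulTerm r s p m) ⟩
  (r ℚ.* q) ℚ.* raise s (δ t) m ℚ.+ r ℚ.* raise s (coef p) m
    ≡⟨ solve 4 (λ r q x y → (r :* q) :* x :+ r :* y := r :* (q :* x :+ y)) refl r q _ _ ⟩
  r ℚ.* (q ℚ.* raise s (δ t) m ℚ.+ raise s (coef p) m)
    ≡⟨ cong (r ℚ.*_) (raise-lin s q (δ t) (coef p) m) ⟨
  r ℚ.* raise s (coef ((q , t) ∷ p)) m ∎
  where open ≡-Reasoning

coef-single : ∀ r s p m → coef (((r , s) ∷ []) *P p) m ≡ r ℚ.* raise s (coef p) m
coef-single r s p m =
  trans (coef-++ (map (mulTerm (r , s)) p) [] m)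
        (trans (ℚP.+-identityʳ _) (coef-mulTerm r s p m))

single-cong : ∀ r s p p' → (∀ m → coef p m ≡ coef p' m) → ∀ m →
              coef (((r , s) ∷ []) *P p) m ≡ coef (((r , s) ∷ []) *P p') m
single-cong r s p p' eq m =
  trans (coef-single r s p m)
        (trans (cong (r ℚ.*_) (raise-cong s (coef p) (coef p') eq m)) (sym (coef-single r s p' m)))

coef-scale : ∀ q p m → coef (scale q p) m ≡ q ℚ.* coef p m
coef-scale q p (i , j , k) = coef-single q (0 , 0 , 0) p (i , j , k)

dmon : Mon → Poly
dmon (i , j , k) = (ν i , i , suc (suc j) , k) ∷ (ν (j + k) , i , suc j , suc k) ∷ []

leibniz-step : ∀ g x s P P' → (∀ m → coef P m ≡ coef P' m) → ∀ m →
  coef (g +P ((x , s) ∷ []) *P P) m ≡ coef g m ℚ.+ coef (((x , s) ∷ []) *P P') m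
leibniz-step g x s P P' eq m =
  trans (coef-++ g _ m) (cong (coef g m ℚ.+_) (single-cong x s P P' eq m))

step-a : ∀ i n d₁ d₂ →
  1ℚ ℚ.* d₁ ℚ.+ 0ℚ ℚ.+ ((1ℚ ℚ.* ν i) ℚ.* d₁ ℚ.+ ((1ℚ ℚ.* ν n) ℚ.* d₂ ℚ.+ 0ℚ))
  ≡ ν (suc i) ℚ.* d₁ ℚ.+ (ν n ℚ.* d₂ ℚ.+ 0ℚ)
step-a i n d₁ d₂ = trans
  (solve 4 (λ x y d₁ d₂ → con 1ℚ :* d₁ :+ con 0ℚ :+ ((con 1ℚ :* x) :* d₁ :+ ((con 1ℚ :* y) :* d₂ :+ con 0ℚ))
                       := (con 1ℚ :+ x) :* d₁ :+ (y :* d₂ :+ con 0ℚ)) refl (ν i) (ν n) d₁ d₂)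
  (cong (λ x → x ℚ.* d₁ ℚ.+ (ν n ℚ.* d₂ ℚ.+ 0ℚ)) (sym (ν-suc i)))

step-bc : ∀ n d₁ d₂ →
  1ℚ ℚ.* d₁ ℚ.+ 0ℚ ℚ.+ ((1ℚ ℚ.* 0ℚ) ℚ.* d₂ ℚ.+ ((1ℚ ℚ.* ν n) ℚ.* d₁ ℚ.+ 0ℚ))
  ≡ 0ℚ ℚ.* d₂ ℚ.+ (ν (suc n) ℚ.* d₁ ℚ.+ 0ℚ)
step-bc n d₁ d₂ = trans
  (solve 3 (λ y d₁ d₂ → con 1ℚ :* d₁ :+ con 0ℚ :+ ((con 1ℚ :* con 0ℚ) :* d₂ :+ ((con 1ℚ :* y) :* d₁ :+ con 0ℚ))
                     := con 0ℚ :* d₂ :+ ((con 1ℚ :+ y) :* d₁ :+ con 0ℚ)) refl (ν n) d₁ d₂)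
  (cong (λ x → 0ℚ ℚ.* d₂ ℚ.+ (x ℚ.* d₁ ℚ.+ 0ℚ)) (sym (ν-suc n)))

Dmon-closed : ∀ i j k m → coef (Dmon i j k) m ≡ coef (dmon (i , j , k)) m
Dmon-closed (suc i) j k m =
  trans (leibniz-step (Da *P mon (i , j , k)) 1ℚ (1 , 0 , 0) (Dmon i j k) (dmon (i , j , k)) (Dmon-closed i j k) m)
        (step-a i (j + k) (δ (suc i , suc (suc j) , k) m) (δ (suc i , suc j , suc k) m))
Dmon-closed zero (suc j) k m =
  trans (leibniz-step (Db *P mon (0 , j , k)) 1ℚ (0 , 1 , 0) (Dmon 0 j k) (dmon (0 , j , k)) (Dmon-closed 0 j k) m)
        (step-bc (j + k) (δ (0 , suc (suc j) , suc k) m) (δ (0 , suc (suc (suc j)) , k) m))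
Dmon-closed zero zero (suc k) m =
  trans (leibniz-step (Dc *P mon (0 , 0 , k)) 1ℚ (0 , 0 , 1) (Dmon 0 0 k) (dmon (0 , 0 , k)) (Dmon-closed 0 0 k) m)
        (step-bc k (δ (0 , 1 , suc (suc k)) m) (δ (0 , 2 , suc k) m))
Dmon-closed zero zero zero m =
  solve 2 (λ d₁ d₂ → con 0ℚ := con 0ℚ :* d₁ :+ (con 0ℚ :* d₂ :+ con 0ℚ)) refl (δ (0 , 2 , 0) m) (δ (0 , 1 , 1) m)

-- Coefficient form of D.  Since D = b²·(a∂/∂a) + bc·(b∂/∂b + c∂/∂c), the
-- coefficients of D(p) arise from those of p by weighting with the Euler
-- degrees and raising by b² resp. bc.

degA degBC : Mon → ℚ
degA (i , _ , _) = ν i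
degBC (_ , j , k) = ν (j + k)

Dcoef : (Mon → ℚ) → Mon → ℚ
Dcoef f m = raise (0 , 2 , 0) (λ t → degA t ℚ.* f t) m ℚ.+ raise (0 , 1 , 1) (λ t → degBC t ℚ.* f t) m

raise-weighted-δ : ∀ s w t m → raise s (λ t' → w t' ℚ.* δ t t') m ≡ w t ℚ.* δ (s ⊕ t) m
raise-weighted-δ s w t m = begin
  raise s (λ t' → w t' ℚ.* δ t t') m  ≡⟨ raise-cong s _ _ (δ-weight w t) m ⟩
  raise s (λ t' → w t ℚ.* δ t t') m   ≡⟨ guard-* (s ∣ᵇ m) (w t) _ ⟩
  w t ℚ.* raise s (δ t) m             ≡⟨ cong (w t ℚ.*_) (δ-⊕ s t m) ⟨
  w t ℚ.* δ (s ⊕ t) m                 ∎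
  where open ≡-Reasoning

dmon-coef : ∀ t m → coef (dmon t) m ≡ Dcoef (δ t) m
dmon-coef t m = sym (cong₂ ℚ._+_
  (raise-weighted-δ (0 , 2 , 0) degA t m)
  (trans (raise-weighted-δ (0 , 1 , 1) degBC t m) (sym (ℚP.+-identityʳ _))))

Dcoef-cong : ∀ f g → (∀ t → f t ≡ g t) → ∀ m → Dcoef f m ≡ Dcoef g m
Dcoef-cong f g eq m = cong₂ ℚ._+_
  (raise-cong (0 , 2 , 0) _ _ (λ t → cong (degA t ℚ.*_) (eq t)) m)
  (raise-cong (0 , 1 , 1) _ _ (λ t → cong (degBC t ℚ.*_) (eq t)) m)

Dcoef-0 : ∀ m → Dcoef (λ _ → 0ℚ) m ≡ 0ℚ
Dcoef-0 m = cong₂ ℚ._+_ (vanish (0 , 2 , 0) degA) (vanish (0 , 1 , 1) degBC)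
  where
  vanish : ∀ s (w : Mon → ℚ) → raise s (λ t → w t ℚ.* 0ℚ) m ≡ 0ℚ
  vanish s w = trans (raise-cong s (λ t → w t ℚ.* 0ℚ) (λ _ → 0ℚ) (λ t → ℚP.*-zeroʳ (w t)) m) (guard-0 (s ∣ᵇ m))

Dcoef-lin : ∀ q f g m → Dcoef (λ t → q ℚ.* f t ℚ.+ g t) m ≡ q ℚ.* Dcoef f m ℚ.+ Dcoef g m
Dcoef-lin q f g m = begin
  Dcoef (λ t → q ℚ.* f t ℚ.+ g t) m
    ≡⟨ cong₂ ℚ._+_ (weighted (0 , 2 , 0) degA) (weighted (0 , 1 , 1) degBC) ⟩
  (q ℚ.* fA ℚ.+ gA) ℚ.+ (q ℚ.* fB ℚ.+ gB)
    ≡⟨ solve 5 (λ q x y z w → (q :* x :+ y) :+ (q :* z :+ w) := q :* (x :+ z) :+ (y :+ w)) refl q fA gA fB gB ⟩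
  q ℚ.* Dcoef f m ℚ.+ Dcoef g m ∎
  where
  open ≡-Reasoning
  part : Mon → (Mon → ℚ) → (Mon → ℚ) → ℚ
  part s w h = raise s (λ t → w t ℚ.* h t) m
  fA gA fB gB : ℚ
  fA = part (0 , 2 , 0) degA f
  gA = part (0 , 2 , 0) degA g
  fB = part (0 , 1 , 1) degBC f
  gB = part (0 , 1 , 1) degBC g
  weighted : ∀ s (w : Mon → ℚ) → raise s (λ t → w t ℚ.* (q ℚ.* f t ℚ.+ g t)) m ≡ q ℚ.* part s w f ℚ.+ part s w g
  weighted s w = trans
    (raise-cong s _ _ (λ t → solve 4 (λ w q x y → w :* (q :* x :+ y) := q :* (w :* x) :+ w :* y) refl (w t) q (f t) (g t)) m)
    (raise-lin s q (λ t → w t ℚ.* f t) (λ t → w t ℚ.* g t) m)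

coef-D-cons : ∀ q t p m → coef (D ((q , t) ∷ p)) m ≡ q ℚ.* coef (dmon t) m ℚ.+ coef (D p) m
coef-D-cons q (i , j , k) p m =
  trans (coef-++ (scale q (Dmon i j k)) (D p) m)
        (cong (ℚ._+ coef (D p) m) (trans (coef-scale q (Dmon i j k) m) (cong (q ℚ.*_) (Dmon-closed i j k m))))

coef-D : ∀ p m → coef (D p) m ≡ Dcoef (coef p) m
coef-D [] m = sym (Dcoef-0 m)
coef-D ((q , t) ∷ p) m =
  trans (coef-D-cons q t p m)
        (trans (cong₂ (λ x y → q ℚ.* x ℚ.+ y) (dmon-coef t m) (coef-D p m))
               (sym (Dcoef-lin q (δ t) (coef p) m)))

D-cong : ∀ p p' → (∀ m → coef p m ≡ coef p' m) → ∀ m → coef (D p) m ≡ coef (D p') m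
D-cong p p' eq m =
  trans (coef-D p m) (trans (Dcoef-cong (coef p) (coef p') eq m) (sym (coef-D p' m)))

sumP : ℕ → (ℕ → Poly) → Poly
sumP zero g = []
sumP (suc n) g = g 0 ++ sumP n (g ∘ suc)

sumQ : ℕ → (ℕ → ℚ) → ℚ
sumQ zero h = 0ℚ
sumQ (suc n) h = h 0 ℚ.+ sumQ n (h ∘ suc)

sumP-cong : ∀ n g g' → (∀ k → g k ≡ g' k) → sumP n g ≡ sumP n g'
sumP-cong zero g g' eq = refl
sumP-cong (suc n) g g' eq = cong₂ _++_ (eq 0) (sumP-cong n (g ∘ suc) (g' ∘ suc) (eq ∘ suc))

sumQ-cong : ∀ n h h' → (∀ k → k < n → h k ≡ h' k) → sumQ n h ≡ sumQ n h'
sumQ-cong zero h h' eq = refl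
sumQ-cong (suc n) h h' eq =
  cong₂ ℚ._+_ (eq 0 (s≤s ℕ.z≤n)) (sumQ-cong n (h ∘ suc) (h' ∘ suc) (λ k k<n → eq (suc k) (s≤s k<n)))

sumQ-lin : ∀ n q h h' → sumQ n (λ k → q ℚ.* h k ℚ.+ h' k) ≡ q ℚ.* sumQ n h ℚ.+ sumQ n h'
sumQ-lin zero q h h' = sym (trans (ℚP.+-identityʳ _) (ℚP.*-zeroʳ q))
sumQ-lin (suc n) q h h' =
  trans (cong (q ℚ.* h 0 ℚ.+ h' 0 ℚ.+_) (sumQ-lin n q (h ∘ suc) (h' ∘ suc)))
        (solve 5 (λ q x y X Y → q :* x :+ y :+ (q :* X :+ Y) := q :* (x :+ X) :+ (y :+ Y)) refl
               q (h 0) (h' 0) (sumQ n (h ∘ suc)) (sumQ n (h' ∘ suc)))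

sumQ-snoc : ∀ n h → sumQ (suc n) h ≡ sumQ n h ℚ.+ h n
sumQ-snoc zero h = trans (ℚP.+-identityʳ (h 0)) (sym (ℚP.+-identityˡ (h 0)))
sumQ-snoc (suc n) h =
  trans (cong (h 0 ℚ.+_) (sumQ-snoc n (h ∘ suc))) (sym (ℚP.+-assoc (h 0) (sumQ n (h ∘ suc)) (h (suc n))))

coef-sumP : ∀ n g m → coef (sumP n g) m ≡ sumQ n (λ k → coef (g k) m)
coef-sumP zero g m = refl
coef-sumP (suc n) g m = trans (coef-++ (g 0) (sumP n (g ∘ suc)) m) (cong (coef (g 0) m ℚ.+_) (coef-sumP n (g ∘ suc) m))

coef-terms : ∀ n (h : ℕ → ℚ) (t : ℕ → Mon) m → coef (sumP n (λ k → (h k , t k) ∷ [])) m ≡ sumQ n (λ k → h k ℚ.* δ (t k) m)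
coef-terms n h t m =
  trans (coef-sumP n (λ k → (h k , t k) ∷ []) m)
        (sumQ-cong n (λ k → coef ((h k , t k) ∷ []) m) (λ k → h k ℚ.* δ (t k) m) (λ k _ → ℚP.+-identityʳ _))

map-sumP : ∀ (F : Term → Term) n g → map F (sumP n g) ≡ sumP n (map F ∘ g)
map-sumP F zero g = refl
map-sumP F (suc n) g = trans (ListP.map-++ F (g 0) (sumP n (g ∘ suc))) (cong (map F (g 0) ++_) (map-sumP F n (g ∘ suc)))

D-++ : ∀ p p' → D (p ++ p') ≡ D p ++ D p'
D-++ [] p' = refl
D-++ ((q , i , j , k) ∷ p) p' =
  trans (cong (scale q (Dmon i j k) ++_) (D-++ p p')) (sym (ListP.++-assoc (scale q (Dmon i j k)) (D p) (D p')))

D-sumP : ∀ n g → D (sumP n g) ≡ sumP n (D ∘ g)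
D-sumP zero g = refl
D-sumP (suc n) g = trans (D-++ (g 0) (sumP n (g ∘ suc))) (cong (D (g 0) ++_) (D-sumP n (g ∘ suc)))

hom : ℕ → ℕ → (ℕ → ℚ) → Poly
hom u v f = sumP (suc v) (λ k → (f k , 1 , u + k , v ∸ k) ∷ [])

hom-cong : ∀ u v f g → (∀ k → f k ≡ g k) → hom u v f ≡ hom u v g
hom-cong u v f g eq = sumP-cong (suc v) _ _ (λ k → cong (λ x → (x , 1 , u + k , v ∸ k) ∷ []) (eq k))

coef-hom : ∀ u v f m → coef (hom u v f) m ≡ sumQ (suc v) (λ k → f k ℚ.* δ (1 , u + k , v ∸ k) m)
coef-hom u v f = coef-terms (suc v) f (λ k → (1 , u + k , v ∸ k))

-- Coefficient sequence of x·f(x).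
xshift : (ℕ → ℚ) → ℕ → ℚ
xshift f zero = 0ℚ
xshift f (suc k) = f k

D-hom : ∀ u v f → f (suc v) ≡ 0ℚ → ∀ m →
        coef (D (hom u v f)) m ≡ coef (hom (suc u) (suc v) (λ k → ν (u + v) ℚ.* f k ℚ.+ xshift f k)) m
D-hom u v f top m = begin
  coef (D (hom u v f)) m
    ≡⟨ cong (λ p → coef p m) (D-sumP (suc v) term) ⟩
  coef (sumP (suc v) (D ∘ term)) m
    ≡⟨ coef-sumP (suc v) (D ∘ term) m ⟩
  sumQ (suc v) (λ k → coef (D (term k)) m)
    ≡⟨ sumQ-cong (suc v) _ _ D-term ⟩
  sumQ (suc v) (λ k → s ℚ.* (f k ℚ.* δB k) ℚ.+ f k ℚ.* δA k)
    ≡⟨ sumQ-lin (suc v) s (λ k → f k ℚ.* δB k) (λ k → f k ℚ.* δA k) ⟩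
  s ℚ.* sumQ (suc v) (λ k → f k ℚ.* δB k) ℚ.+ sumQ (suc v) (λ k → f k ℚ.* δA k)
    ≡⟨ cong₂ (λ x y → s ℚ.* x ℚ.+ y) same-degree raised-degree ⟨
  s ℚ.* sumQ (suc (suc v)) (λ k → f k ℚ.* δ′ k) ℚ.+ sumQ (suc (suc v)) (λ k → xshift f k ℚ.* δ′ k)
    ≡⟨ sumQ-lin (suc (suc v)) s (λ k → f k ℚ.* δ′ k) (λ k → xshift f k ℚ.* δ′ k) ⟨
  sumQ (suc (suc v)) (λ k → s ℚ.* (f k ℚ.* δ′ k) ℚ.+ xshift f k ℚ.* δ′ k)
    ≡⟨ sumQ-cong (suc (suc v)) _ _ (λ k _ → solve 4 (λ s x y d → s :* (x :* d) :+ y :* d := (s :* x :+ y) :* d)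
                                                    refl s (f k) (xshift f k) (δ′ k)) ⟩
  sumQ (suc (suc v)) (λ k → (s ℚ.* f k ℚ.+ xshift f k) ℚ.* δ′ k)
    ≡⟨ coef-hom (suc u) (suc v) (λ k → s ℚ.* f k ℚ.+ xshift f k) m ⟨
  coef (hom (suc u) (suc v) (λ k → s ℚ.* f k ℚ.+ xshift f k)) m ∎
  where
  open ≡-Reasoning
  s : ℚ
  s = ν (u + v)
  term : ℕ → Poly
  term k = (f k , 1 , u + k , v ∸ k) ∷ []
  δA δB δ′ : ℕ → ℚ
  δA k = δ (1 , suc (suc (u + k)) , v ∸ k) m
  δB k = δ (1 , suc (u + k) , suc (v ∸ k)) m
  δ′ k = δ (1 , suc u + k , suc v ∸ k) m

  D-term : ∀ k → k < suc v → coef (D (term k)) m ≡ s ℚ.* (f k ℚ.* δB k) ℚ.+ f k ℚ.* δA k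
  D-term k (s≤s k≤v) = begin
    coef (D (term k)) m
      ≡⟨ coef-D-cons (f k) (1 , u + k , v ∸ k) [] m ⟩
    f k ℚ.* (1ℚ ℚ.* δA k ℚ.+ (ν (u + k + (v ∸ k)) ℚ.* δB k ℚ.+ 0ℚ)) ℚ.+ 0ℚ
      ≡⟨ cong (λ n → f k ℚ.* (1ℚ ℚ.* δA k ℚ.+ (ν n ℚ.* δB k ℚ.+ 0ℚ)) ℚ.+ 0ℚ)
              (trans (ℕP.+-assoc u k (v ∸ k)) (cong (u +_) (ℕP.m+[n∸m]≡n k≤v))) ⟩
    f k ℚ.* (1ℚ ℚ.* δA k ℚ.+ (s ℚ.* δB k ℚ.+ 0ℚ)) ℚ.+ 0ℚ
      ≡⟨ solve 4 (λ x a b s → x :* (con 1ℚ :* a :+ (s :* b :+ con 0ℚ)) :+ con 0ℚ := s :* (x :* b) :+ x :* a)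
               refl (f k) (δA k) (δB k) s ⟩
    s ℚ.* (f k ℚ.* δB k) ℚ.+ f k ℚ.* δA k ∎

  -- the terms s·f(k)·b^(u+1+k) c^(v+1−k), the last of which vanishes
  same-degree : sumQ (suc (suc v)) (λ k → f k ℚ.* δ′ k) ≡ sumQ (suc v) (λ k → f k ℚ.* δB k)
  same-degree = begin
    sumQ (suc (suc v)) (λ k → f k ℚ.* δ′ k)
      ≡⟨ sumQ-snoc (suc v) (λ k → f k ℚ.* δ′ k) ⟩
    sumQ (suc v) (λ k → f k ℚ.* δ′ k) ℚ.+ f (suc v) ℚ.* δ′ (suc v)
      ≡⟨ cong (λ x → sumQ (suc v) (λ k → f k ℚ.* δ′ k) ℚ.+ x ℚ.* δ′ (suc v)) top ⟩
    sumQ (suc v) (λ k → f k ℚ.* δ′ k) ℚ.+ 0ℚ ℚ.* δ′ (suc v)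
      ≡⟨ solve 2 (λ x d → x :+ con 0ℚ :* d := x) refl (sumQ (suc v) (λ k → f k ℚ.* δ′ k)) (δ′ (suc v)) ⟩
    sumQ (suc v) (λ k → f k ℚ.* δ′ k)
      ≡⟨ sumQ-cong (suc v) _ _ (λ { k (s≤s k≤v) →
           cong (λ e → f k ℚ.* δ (1 , suc (u + k) , e) m) (ℕP.+-∸-assoc 1 k≤v) }) ⟩
    sumQ (suc v) (λ k → f k ℚ.* δB k) ∎

  -- the terms f(k−1)·b^(u+1+k) c^(v+1−k), whose first one vanishes
  raised-degree : sumQ (suc (suc v)) (λ k → xshift f k ℚ.* δ′ k) ≡ sumQ (suc v) (λ k → f k ℚ.* δA k)
  raised-degree = begin
    0ℚ ℚ.* δ′ 0 ℚ.+ sumQ (suc v) (λ k → f k ℚ.* δ′ (suc k))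
      ≡⟨ solve 2 (λ d x → con 0ℚ :* d :+ x := x) refl (δ′ 0) (sumQ (suc v) (λ k → f k ℚ.* δ′ (suc k))) ⟩
    sumQ (suc v) (λ k → f k ℚ.* δ′ (suc k))
      ≡⟨ sumQ-cong (suc v) _ _ (λ k _ → cong (λ e → f k ℚ.* δ (1 , suc e , v ∸ k) m) (ℕP.+-suc u k)) ⟩
    sumQ (suc v) (λ k → f k ℚ.* δA k) ∎

ucoeff-mulLin : ∀ c p k → ucoeff (mulLin c p) k ≡ c ℤ.* ucoeff p k ℤ.+ ucoeff (ℤ.0ℤ ∷ p) k
ucoeff-mulLin c [] zero = sym (trans (ℤP.+-identityʳ _) (ℤP.*-zeroʳ c))
ucoeff-mulLin c [] (suc k) = sym (trans (ℤP.+-identityʳ _) (ℤP.*-zeroʳ c))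
ucoeff-mulLin c (x ∷ []) zero = refl
ucoeff-mulLin c (x ∷ []) (suc zero) = sym (trans (cong (ℤ._+ x) (ℤP.*-zeroʳ c)) (ℤP.+-identityˡ x))
ucoeff-mulLin c (x ∷ []) (suc (suc k)) = sym (trans (ℤP.+-identityʳ _) (ℤP.*-zeroʳ c))
ucoeff-mulLin c (x ∷ x' ∷ p) zero = refl
ucoeff-mulLin c (x ∷ x' ∷ p) (suc zero) = refl
ucoeff-mulLin c (x ∷ x' ∷ p) (suc (suc k)) = ucoeff-mulLin c (x' ∷ p) (suc k)

prodLin-degree : ∀ f n k → n < k → ucoeff (prodLin f n) k ≡ ℤ.0ℤ
prodLin-degree f zero (suc k) _ = refl
prodLin-degree f (suc n) (suc k) (s≤s n<k) = begin
  ucoeff (mulLin (f n) (prodLin f n)) (suc k)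
    ≡⟨ ucoeff-mulLin (f n) (prodLin f n) (suc k) ⟩
  f n ℤ.* ucoeff (prodLin f n) (suc k) ℤ.+ ucoeff (prodLin f n) k
    ≡⟨ cong₂ (λ x y → f n ℤ.* x ℤ.+ y) (prodLin-degree f n (suc k) (ℕP.m<n⇒m<1+n n<k)) (prodLin-degree f n k n<k) ⟩
  f n ℤ.* ℤ.0ℤ ℤ.+ ℤ.0ℤ
    ≡⟨ trans (ℤP.+-identityʳ _) (ℤP.*-zeroʳ (f n)) ⟩
  ℤ.0ℤ ∎
  where open ≡-Reasoning

prodLin-root : ∀ f → f 0 ≡ ℤ.0ℤ → ∀ n → ucoeff (prodLin f (suc n)) 0 ≡ ℤ.0ℤ
prodLin-root f f0 n = trans (ucoeff-mulLin (f n) (prodLin f n) 0) (trans (ℤP.+-identityʳ _) (last-factor n))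
  where
  last-factor : ∀ n → f n ℤ.* ucoeff (prodLin f n) 0 ≡ ℤ.0ℤ
  last-factor zero = trans (ℤP.*-identityʳ (f 0)) f0
  last-factor (suc n) = trans (cong (f (suc n) ℤ.*_) (prodLin-root f f0 n)) (ℤP.*-zeroʳ (f (suc n)))

prodLin-cong : ∀ f g → (∀ i → f i ≡ g i) → ∀ n → prodLin f n ≡ prodLin g n
prodLin-cong f g eq zero = refl
prodLin-cong f g eq (suc n) = cong₂ mulLin (eq n) (prodLin-cong f g eq n)

qcoeff : UPoly → ℕ → ℚ
qcoeff p k = ι (ucoeff p k)

qcoeff-mulLin : ∀ s p k → qcoeff (mulLin (ℤ.+ s) p) k ≡ ν s ℚ.* qcoeff p k ℚ.+ xshift (qcoeff p) k
qcoeff-mulLin s p k = begin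
  ι (ucoeff (mulLin (ℤ.+ s) p) k)                     ≡⟨ cong ι (ucoeff-mulLin (ℤ.+ s) p k) ⟩
  ι (ℤ.+ s ℤ.* ucoeff p k ℤ.+ ucoeff (ℤ.0ℤ ∷ p) k)    ≡⟨ ι-+ (ℤ.+ s ℤ.* ucoeff p k) _ ⟩
  ι (ℤ.+ s ℤ.* ucoeff p k) ℚ.+ qcoeff (ℤ.0ℤ ∷ p) k    ≡⟨ cong₂ ℚ._+_ (ι-* (ℤ.+ s) (ucoeff p k)) (shifted k) ⟩
  ν s ℚ.* qcoeff p k ℚ.+ xshift (qcoeff p) k          ∎
  where
  open ≡-Reasoning
  shifted : ∀ k → qcoeff (ℤ.0ℤ ∷ p) k ≡ xshift (qcoeff p) k
  shifted zero = refl
  shifted (suc k) = refl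

D-power : ∀ u n m → coef (D^ n (hom u 0 (qcoeff (ℤ.1ℤ ∷ [])))) m
                  ≡ coef (hom (u + n) n (qcoeff (prodLin (λ i → ℤ.+ (u + 2 * i)) n))) m
D-power u zero m = cong (λ w → coef (hom w 0 (qcoeff (ℤ.1ℤ ∷ []))) m) (sym (ℕP.+-identityʳ u))
D-power u (suc n) m = begin
  coef (D (D^ n (hom u 0 (qcoeff (ℤ.1ℤ ∷ []))))) m
    ≡⟨ D-cong (D^ n (hom u 0 (qcoeff (ℤ.1ℤ ∷ [])))) (hom (u + n) n (qcoeff P)) (D-power u n) m ⟩
  coef (D (hom (u + n) n (qcoeff P))) m
    ≡⟨ D-hom (u + n) n (qcoeff P) (cong ι (prodLin-degree factor n (suc n) (ℕP.n<1+n n))) m ⟩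
  coef (hom (suc (u + n)) (suc n) (λ k → ν (u + n + n) ℚ.* qcoeff P k ℚ.+ xshift (qcoeff P) k)) m
    ≡⟨ cong₂ (λ w s → coef (hom w (suc n) (λ k → ν s ℚ.* qcoeff P k ℚ.+ xshift (qcoeff P) k)) m)
             (sym (ℕP.+-suc u n)) (trans (ℕP.+-assoc u n n) (cong (λ x → u + (n + x)) (sym (ℕP.+-identityʳ n)))) ⟩
  coef (hom (u + suc n) (suc n) (λ k → ν (u + 2 * n) ℚ.* qcoeff P k ℚ.+ xshift (qcoeff P) k)) m
    ≡⟨ cong (λ p → coef p m) (hom-cong (u + suc n) (suc n) _ _ (λ k → sym (qcoeff-mulLin (u + 2 * n) P k))) ⟩
  coef (hom (u + suc n) (suc n) (qcoeff (mulLin (factor n) P))) m ∎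
  where
  open ≡-Reasoning
  factor : ℕ → ℤ
  factor i = ℤ.+ (u + 2 * i)
  P : UPoly
  P = prodLin factor n

powB : ∀ n → varB ^P n ≡ (1ℚ , 0 , n , 0) ∷ []
powB zero = refl
powB (suc n) rewrite powB n = refl

powC : ∀ n → varC ^P n ≡ (1ℚ , 0 , 0 , n) ∷ []
powC zero = refl
powC (suc n) rewrite powC n = refl

sumFromTo-sumP : ∀ lo hi g → sumFromTo lo hi g ≡ sumP (suc hi ∸ lo) (λ k → g (lo + k))
sumFromTo-sumP lo hi g = fold (λ k → k) (suc hi ∸ lo)
  where
  fold : ∀ h n → foldr (λ k acc → g (lo + k) +P acc) 0P (applyUpTo h n) ≡ sumP n (λ k → g (lo + h k))
  fold h zero = refl
  fold h (suc n) = cong (g (lo + h 0) ++_) (fold (h ∘ suc) n)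

term-form : ∀ N z k l → map (mulTerm (1ℚ , 1 , N , 0)) (intP z *P varB ^P k *P varC ^P l) ≡ (ι z , 1 , N + k , l) ∷ []
term-form N z k l rewrite powB k | powC l =
  cong₂ (λ q e → (q , 1 , N + e , l) ∷ [])
        (trans (ℚP.*-identityˡ _) (trans (ℚP.*-identityʳ _) (ℚP.*-identityʳ (ι z))))
        (ℕP.+-identityʳ k)

rhs-sum : ∀ N n lo (z : ℕ → ℤ) m →
  coef (varA *P varB ^P N *P sumFromTo lo n (λ k → intP (z k) *P varB ^P k *P varC ^P (n ∸ k))) m
  ≡ sumQ (suc n ∸ lo) (λ k → ι (z (lo + k)) ℚ.* δ (1 , N + (lo + k) , n ∸ (lo + k)) m)
rhs-sum N n lo z m rewrite powB N = begin
  coef (map (mulTerm (1ℚ , 1 , N , 0)) (sumFromTo lo n g) ++ []) m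
    ≡⟨ cong (λ p → coef (p ++ []) m) rhs-terms ⟩
  coef (sumP (suc n ∸ lo) terms ++ []) m
    ≡⟨ trans (coef-++ (sumP (suc n ∸ lo) terms) [] m) (ℚP.+-identityʳ _) ⟩
  coef (sumP (suc n ∸ lo) terms) m
    ≡⟨ coef-terms (suc n ∸ lo) (λ k → ι (z (lo + k))) (λ k → (1 , N + (lo + k) , n ∸ (lo + k))) m ⟩
  sumQ (suc n ∸ lo) (λ k → ι (z (lo + k)) ℚ.* δ (1 , N + (lo + k) , n ∸ (lo + k)) m) ∎
  where
  open ≡-Reasoning
  g : ℕ → Poly
  g k = intP (z k) *P varB ^P k *P varC ^P (n ∸ k)
  terms : ℕ → Poly
  terms k = (ι (z (lo + k)) , 1 , N + (lo + k) , n ∸ (lo + k)) ∷ []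
  rhs-terms : map (mulTerm (1ℚ , 1 , N , 0)) (sumFromTo lo n g) ≡ sumP (suc n ∸ lo) terms
  rhs-terms = begin
    map (mulTerm (1ℚ , 1 , N , 0)) (sumFromTo lo n g)
      ≡⟨ cong (map (mulTerm (1ℚ , 1 , N , 0))) (sumFromTo-sumP lo n g) ⟩
    map (mulTerm (1ℚ , 1 , N , 0)) (sumP (suc n ∸ lo) (λ k → g (lo + k)))
      ≡⟨ map-sumP (mulTerm (1ℚ , 1 , N , 0)) (suc n ∸ lo) (λ k → g (lo + k)) ⟩
    sumP (suc n ∸ lo) (λ k → map (mulTerm (1ℚ , 1 , N , 0)) (g (lo + k)))
      ≡⟨ sumP-cong (suc n ∸ lo) _ terms (λ k → term-form N (z (lo + k)) (lo + k) (n ∸ (lo + k))) ⟩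
    sumP (suc n ∸ lo) terms ∎

rhs-a rhs-ab : ℕ → Poly
rhs-a n = varA *P varB ^P n *P sumFromTo 1 n (λ k → intP (pnk n k) *P varB ^P k *P varC ^P (n ∸ k))
rhs-ab n = varA *P varB ^P (n + 1) *P sumFromTo 0 n (λ k → intP (qnk n k) *P varB ^P k *P varC ^P (n ∸ k))

iterate-a : ∀ n m → coef (D^ (suc n) varA) m ≡ coef (rhs-a (suc n)) m
iterate-a n m = begin
  coef (D^ N varA) m
    ≡⟨ D-power 0 N m ⟩
  coef (hom N N (qcoeff P)) m
    ≡⟨ coef-hom N N (qcoeff P) m ⟩
  qcoeff P 0 ℚ.* δ (1 , N + 0 , N) m ℚ.+ rest
    ≡⟨ cong (λ x → ι x ℚ.* δ (1 , N + 0 , N) m ℚ.+ rest) (prodLin-root (λ i → ℤ.+ (2 * i)) refl n) ⟩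
  0ℚ ℚ.* δ (1 , N + 0 , N) m ℚ.+ rest
    ≡⟨ solve 2 (λ d x → con 0ℚ :* d :+ x := x) refl (δ (1 , N + 0 , N) m) rest ⟩
  rest
    ≡⟨ rhs-sum N N 1 (pnk N) m ⟨
  coef (rhs-a N) m ∎
  where
  open ≡-Reasoning
  N : ℕ
  N = suc n
  P : UPoly
  P = prodLin (λ i → ℤ.+ (2 * i)) N
  rest : ℚ
  rest = sumQ N (λ k → qcoeff P (suc k) ℚ.* δ (1 , N + suc k , N ∸ suc k) m)

iterate-ab : ∀ N m → coef (D^ N (varA *P varB)) m ≡ coef (rhs-ab N) m
iterate-ab N m = begin
  coef (D^ N (varA *P varB)) m
    ≡⟨ D-power 1 N m ⟩
  coef (hom (1 + N) N (qcoeff (prodLin (λ i → ℤ.+ (1 + 2 * i)) N))) m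
    ≡⟨ cong₂ (λ w Q → coef (hom w N (qcoeff Q)) m) (ℕP.+-comm 1 N)
             (prodLin-cong _ _ (λ i → cong ℤ.+_ (ℕP.+-comm 1 (2 * i))) N) ⟩
  coef (hom (N + 1) N (qcoeff Q)) m
    ≡⟨ coef-hom (N + 1) N (qcoeff Q) m ⟩
  sumQ (suc N) (λ k → qcoeff Q k ℚ.* δ (1 , N + 1 + k , N ∸ k) m)
    ≡⟨ rhs-sum (N + 1) N 0 (qnk N) m ⟨
  coef (rhs-ab N) m ∎
  where
  open ≡-Reasoning
  Q : UPoly
  Q = prodLin (λ i → ℤ.+ (2 * i + 1)) N

theorem4 : ∀ (n : ℕ) → 1 ≤ n →
    (D^ n varA ≈ varA *P varB ^P n *P sumFromTo 1 n (λ k → intP (pnk n k) *P varB ^P k *P varC ^P (n ∸ k)))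
    × (D^ n (varA *P varB) ≈ varA *P varB ^P (n + 1) *P sumFromTo 0 n (λ k → intP (qnk n k) *P varB ^P k *P varC ^P (n ∸ k)))
theorem4 (suc n) _ =
  ≈-fromCoef (D^ (suc n) varA) (rhs-a (suc n)) (iterate-a n) ,
  ≈-fromCoef (D^ (suc n) (varA *P varB)) (rhs-ab (suc n)) (iterate-ab (suc n))
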